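{- Every tree $F$ with $n\geq 1$ vertices is a minor of $\Gamma_{n-1}$ in such a way that the branch set of each vertex of $F$ contains a leaf of $\Gamma_{n-1}$.
   Context: $\Gamma_m$ is the complete binary tree of height $m$ (rooted; every non-leaf vertex has two children; $2^m$ leaves; every root-to-leaf path has $m$ edges); $\Gamma_0$ is a single vertex, which is its leaf. If $H$ is a minor of $G$ and $v\in V(H)$, the branch set of $v$ is the set of vertices of $G$ contracted to $v$. -}

module Defs where

open import Data.Nat using (ℕ; _≤_)
open import Data.Fin using (Fin)
open import Data.Bool using (Bool)
open import Data.List using (List; []; _∷_; length; _++_; [_])
open import Data.List.Relation.Unary.Linked using (Linked)
open import Data.List.Relation.Unary.Unique.Propositional using (Unique)
open import Data.Product using (Σ; ∃; _×_; proj₁)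
open import Relation.Binary.PropositionalEquality using (_≡_)
open import Relation.Nullary using (¬_)
open import Data.Unit using (⊤)
open import Data.Sum using (_⊎_)

record Graph : Set₁ where
  field
    V : Set
    E : V → V → Set
open Graph public

data WalkIn (G : Graph) (P : V G → Set) : V G → V G → Set where
  here : ∀ {x} → P x → WalkIn G P x x
  step : ∀ {x y z} → P x → E G x y → WalkIn G P y z → WalkIn G P x z

InducedConnected : (G : Graph) → (V G → Set) → Set
InducedConnected G P = ∀ x y → P x → P y → WalkIn G P x y

record SimpleGraph (n : ℕ) : Set₁ where
  field
    Adj   : Fin n → Fin n → Set
    sym   : ∀ {x y} → Adj x y → Adj y x
    irrefl : ∀ {x} → ¬ Adj x x

toGraph : ∀ {n} → SimpleGraph n → Graph
toGraph {n} F = record { V = Fin n ; E = SimpleGraph.Adj F }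

record Cycle {A : Set} (E : A → A → Set) : Set where
  field
    start  : A
    rest   : List A
    long   : 2 ≤ length rest
    unique : Unique (start ∷ rest)
    linked : Linked E (start ∷ rest ++ [ start ])

record IsTree {n : ℕ} (F : SimpleGraph n) : Set where
  field
    connected : InducedConnected (toGraph F) (λ _ → ⊤)
    acyclic   : ¬ Cycle (SimpleGraph.Adj F)

-- The complete binary tree Γ_m of height m.  A vertex is the address of
-- a node: the list of left/right choices from the root (most recent choice
-- first), of length at most m.  The root is [], the children of w are
-- b ∷ w, and the leaves are the addresses of length exactly m.
ΓV : ℕ → Set
ΓV m = Σ (List Bool) (λ w → length w ≤ m)

ΓAdj : ∀ {m} → ΓV m → ΓV m → Set
ΓAdj x y = (∃ λ b → proj₁ y ≡ b ∷ proj₁ x) ⊎ (∃ λ b → proj₁ x ≡ b ∷ proj₁ y)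

Γ : ℕ → Graph
Γ m = record { V = ΓV m ; E = ΓAdj }

IsLeaf : ∀ {m} → ΓV m → Set
IsLeaf {m} x = length (proj₁ x) ≡ m

record MinorModel (H G : Graph) : Set₁ where
  field
    branch    : V H → V G → Set
    nonempty  : ∀ v → ∃ λ x → branch v x
    disjoint  : ∀ u v x → branch u x → branch v x → u ≡ v
    connected : ∀ v → InducedConnected G (branch v)
    edges     : ∀ u v → E H u v →
                ∃ λ x → ∃ λ y → branch u x × branch v y × E G x y

module Submission where

-- Root F at vertex 0 and order its vertices so that every vertex v
-- other than the root has an earlier neighbour, its parent p v; such an
-- order exists in every connected graph (grow an explored set along edges).
-- In a tree every edge joins a vertex to its parent: any other edge would
-- close a cycle through earlier vertices.  Give the vertex of index i an
-- address of length i in Γ_{n-1}: the root gets the empty address, and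
--     address v = true ∷ false^(i ∸ (j + 1)) ++ address (p v),  j = index (p v).
-- The branch set of v is the "column" of nodes false^a ++ address v below
-- address v.  Columns are paths reaching a leaf, distinct columns are
-- disjoint (no address starts with false, and addresses have distinct
-- lengths), and the tree edge p v — v is realised by the Γ-edge from
-- false^(i ∸ (j + 1)) ++ address (p v) to its right child address v.

open import Defs
open import Data.Nat using (ℕ; zero; suc; _≤_; _<_; _∸_; _+_; z≤n; s≤s)
open import Data.Nat.Properties
  using (≤-refl; ≤-reflexive; ≤-trans; <-≤-trans; ≤-<-trans; ≤-pred; <-irrefl;
         <-cmp; n≮0; <⇒≤; m<n⇒m<1+n; m≤m+n; m∸n+n≡m; +-suc; +-identityʳ; ≤-irrelevant)
open import Data.Nat.Induction using (<-wellFounded)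
open import Induction.WellFounded using (Acc; acc)
open import Data.Fin as Fin using (Fin)
open import Data.Fin.Properties using (_≟_; ≡-decSetoid; all?; ¬∀⟶∃¬)
open import Data.Vec.Functional using (updateAt)
open import Data.Vec.Functional.Properties using (updateAt-updates; updateAt-minimal)
open import Data.Bool using (Bool; true; false)
open import Data.List using (List; []; _∷_; length; _++_; [_]; replicate)
open import Data.List.Properties using (length-++; length-replicate; length-++-≤ʳ; ∷-injectiveʳ)
open import Data.List.Membership.Propositional using (_∈_; _∉_)
open import Data.List.Relation.Unary.Any using (here; there; any?)
open import Data.List.Relation.Unary.All as All using (All; []; _∷_)
open import Data.List.Relation.Unary.All.Properties using (¬Any⇒All¬)
open import Data.List.Relation.Unary.AllPairs using ([]; _∷_)
open import Data.List.Relation.Unary.Linked using (Linked; [-]; _∷_)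
open import Data.List.Relation.Unary.Unique.Propositional using (Unique)
open import Data.Product using (Σ; ∃; ∃₂; _×_; _,_; proj₁; proj₂)
open import Data.Sum using (_⊎_; inj₁; inj₂; swap)
open import Data.Empty using (⊥-elim)
open import Data.Unit using (⊤; tt)
open import Function using (const)
open import Function.Construct.Identity using (↣-id)
open import Relation.Binary using (DecidableEquality; tri<; tri≈; tri>)
open import Relation.Nullary using (¬_; yes; no)
open import Relation.Unary using (Decidable)
open import Relation.Binary.PropositionalEquality
  using (_≡_; _≢_; refl; sym; trans; cong; subst; module ≡-Reasoning)

weaken : ∀ {G} {P Q : V G → Set} → (∀ {z} → P z → Q z) →
         ∀ {x y} → WalkIn G P x y → WalkIn G Q x y
weaken P⇒Q (here px) = here (P⇒Q px)
weaken P⇒Q (step px e w) = step (P⇒Q px) e (weaken P⇒Q w)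

module _ {G : Graph} {P : V G → Set} where

  vertices : ∀ {x y} → WalkIn G P x y → List (V G)
  vertices (here {x} _) = [ x ]
  vertices (step {x} _ _ w) = x ∷ vertices w

  vertices-in : ∀ {x y} (w : WalkIn G P x y) → All P (vertices w)
  vertices-in (here px) = px ∷ []
  vertices-in (step px _ w) = px ∷ vertices-in w

  infixr 5 _++ʷ_
  _++ʷ_ : ∀ {x y z} → WalkIn G P x y → WalkIn G P y z → WalkIn G P x z
  here _ ++ʷ w′ = w′
  step px e w ++ʷ w′ = step px e (w ++ʷ w′)

  snoc : ∀ {x y z} → WalkIn G P x y → E G y z → P z → WalkIn G P x z
  snoc (here py) e pz = step py e (here pz)
  snoc (step px e w) e′ pz = step px e (snoc w e′ pz)

  reverse : (∀ {x y} → E G x y → E G y x) → ∀ {x y} → WalkIn G P x y → WalkIn G P y x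
  reverse E-sym (here px) = here px
  reverse E-sym (step px e w) = snoc (reverse E-sym w) (E-sym e) px

  exit-edge : {Q : V G → Set} → Decidable Q → ∀ {x z} → WalkIn G P x z → Q x → ¬ Q z →
              ∃₂ λ s y → Q s × ¬ Q y × E G s y
  exit-edge Q? (here _) qx ¬qz = ⊥-elim (¬qz qx)
  exit-edge Q? (step {y = y} _ e w) qx ¬qz with Q? y
  ... | yes qy = exit-edge Q? w qy ¬qz
  ... | no ¬qy = _ , y , qx , ¬qy , e

  Path : V G → V G → Set
  Path x y = Σ (WalkIn G P x y) λ w → Unique (vertices w)

  suffix : ∀ {x y z} (π : Path y z) → x ∈ vertices (proj₁ π) → Path x z
  suffix (here py , u) (here refl) = here py , u
  suffix (step py e w , u) (here refl) = step py e w , u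
  suffix (step _ _ w , _ ∷ u) (there x∈w) = suffix (w , u) x∈w

  loop-erase : DecidableEquality (V G) → ∀ {x y} → WalkIn G P x y → Path x y
  loop-erase _ (here px) = here px , [] ∷ []
  loop-erase _≟ᴳ_ {x} (step px e w) with loop-erase _≟ᴳ_ w
  ... | π with any? (x ≟ᴳ_) (vertices (proj₁ π))
  ... | yes x∈π = suffix π x∈π
  ... | no x∉π = step px e (proj₁ π) , ¬Any⇒All¬ _ x∉π ∷ proj₂ π

  linked-around : ∀ {x a b c} → E G x a → (w : WalkIn G P a b) → E G b c →
                  Linked (E G) (x ∷ vertices w ++ [ c ])
  linked-around e (here _) e′ = e ∷ e′ ∷ [-]
  linked-around e (step _ e₁ w) e′ = e ∷ linked-around e₁ w e′

  two-vertices : ∀ {x y} → x ≢ y → (w : WalkIn G P x y) → 2 ≤ length (vertices w)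
  two-vertices x≢y (here _) = ⊥-elim (x≢y refl)
  two-vertices _ (step _ _ (here _)) = s≤s (s≤s z≤n)
  two-vertices _ (step _ _ (step _ _ _)) = s≤s (s≤s z≤n)

  -- A vertex x adjacent to both ends a ≢ b of a walk avoiding x lies on a
  -- cycle (x followed by a loop-erased version of the walk).
  close-cycle : DecidableEquality (V G) → ∀ {x a b} → E G x a → E G b x → a ≢ b →
                WalkIn G P a b → (∀ {z} → P z → x ≢ z) → Cycle (E G)
  close-cycle _≟ᴳ_ {x} x~a b~x a≢b w avoids-x = record
    { start  = x
    ; rest   = vertices (proj₁ π)
    ; long   = two-vertices a≢b (proj₁ π)
    ; unique = All.map avoids-x (vertices-in (proj₁ π)) ∷ proj₂ π
    ; linked = linked-around x~a (proj₁ π) b~x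
    }
    where
    π : Path _ _
    π = loop-erase _≟ᴳ_ w

falses : ℕ → List Bool
falses a = replicate a false

length-falses++ : ∀ a w → length (falses a ++ w) ≡ a + length w
length-falses++ a w = trans (length-++ (falses a)) (cong (_+ length w) (length-replicate a))

NoLeadingFalse : List Bool → Set
NoLeadingFalse w = ∀ t → w ≢ false ∷ t

falses-cancel : ∀ a b {w w′} → NoLeadingFalse w → NoLeadingFalse w′ →
                falses a ++ w ≡ falses b ++ w′ → w ≡ w′
falses-cancel zero zero _ _ eq = eq
falses-cancel zero (suc b) nf _ eq = ⊥-elim (nf _ eq)
falses-cancel (suc a) zero _ nf′ eq = ⊥-elim (nf′ _ (sym eq))
falses-cancel (suc a) (suc b) nf nf′ eq = falses-cancel a b nf nf′ (∷-injectiveʳ eq)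

-- w′ is the right child of a node in the column below w.
HangsFrom : List Bool → List Bool → Set
HangsFrom w w′ = ∃ λ k → w′ ≡ true ∷ falses k ++ w

module _ {m : ℕ} where

  Column : List Bool → ΓV m → Set
  Column w x = ∃ λ a → proj₁ x ≡ falses a ++ w

  Γ-sym : {x y : ΓV m} → ΓAdj {m} x y → ΓAdj {m} y x
  Γ-sym = swap

  node-≡ : (x y : ΓV m) → proj₁ x ≡ proj₁ y → x ≡ y
  node-≡ (w , p) (.w , q) refl = cong (w ,_) (≤-irrelevant p q)

  suffix-fits : ∀ (x : ΓV m) {u w} → proj₁ x ≡ u ++ w → length w ≤ m
  suffix-fits (_ , fits) {u} refl = ≤-trans (length-++-≤ʳ _ {u}) fits

  climb : ∀ {w} a (x : ΓV m) (fits : length w ≤ m) → proj₁ x ≡ falses a ++ w →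
          WalkIn (Γ m) (Column w) x (w , fits)
  climb zero x fits eq = subst (WalkIn _ _ x) (node-≡ x _ eq) (here (0 , eq))
  climb (suc a) x fits eq =
    step (suc a , eq) (inj₂ (false , eq)) (climb a (_ , suffix-fits x {[ false ]} eq) fits refl)

  column-connected : ∀ w → InducedConnected (Γ m) (Column w)
  column-connected w x y (a , eqx) (b , eqy) =
    climb a x fits eqx ++ʷ reverse (λ {x} {y} → Γ-sym {x} {y}) (climb b y fits eqy)
    where
    fits : length w ≤ m
    fits = suffix-fits x {falses a} eqx

  column-leaf : ∀ {w} → length w ≤ m → ∃ λ x → Column w x × IsLeaf {m} x
  column-leaf {w} fits = (_ , ≤-reflexive full) , (m ∸ length w , refl) , full
    where
    full : length (falses (m ∸ length w) ++ w) ≡ m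
    full = trans (length-falses++ (m ∸ length w) w) (m∸n+n≡m fits)

  hanging-edge : ∀ {w w′} → HangsFrom w w′ → length w′ ≤ m →
                 ∃₂ λ x y → Column w x × Column w′ y × ΓAdj x y
  hanging-edge {w} {w′} (k , eq) fits =
    (falses k ++ w , suffix-fits (w′ , fits) {[ true ]} eq) , (w′ , fits) ,
    (k , refl) , (0 , refl) , inj₁ (true , eq)

record BinaryPlacement (H : Graph) (m : ℕ) : Set where
  field
    address           : V H → List Bool
    address-fits      : ∀ v → length (address v) ≤ m
    address-injective : ∀ {u v} → address u ≡ address v → u ≡ v
    address-no-false  : ∀ v → NoLeadingFalse (address v)
    address-edge      : ∀ {u v} → E H u v →
                        HangsFrom (address u) (address v) ⊎ HangsFrom (address v) (address u)

placement⇒minor : ∀ {H m} → BinaryPlacement H m →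
  ∃ λ (M : MinorModel H (Γ m)) → ∀ v → ∃ λ x → MinorModel.branch M v x × IsLeaf {m} x
placement⇒minor {H} {m} B = model , λ v → column-leaf (address-fits v)
  where
  open BinaryPlacement B

  edges : ∀ u v → E H u v → ∃₂ λ x y → Column (address u) x × Column (address v) y × ΓAdj x y
  edges u v e with address-edge e
  ... | inj₁ u→v = hanging-edge u→v (address-fits v)
  ... | inj₂ v→u with hanging-edge v→u (address-fits u)
  ... | x , y , cx , cy , x~y = y , x , cy , cx , Γ-sym {m} {x} {y} x~y

  model : MinorModel H (Γ m)
  model = record
    { branch    = λ v → Column (address v)
    ; nonempty  = λ v → (address v , address-fits v) , (0 , refl)
    ; disjoint  = λ { u v x (a , eu) (b , ev) → address-injective
                      (falses-cancel a b (address-no-false u) (address-no-false v) (trans (sym eu) ev)) }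
    ; connected = λ v → column-connected (address v)
    ; edges     = edges
    }

module _ {N : ℕ} (F : SimpleGraph N) (r : Fin N) where
  open SimpleGraph F using (Adj) renaming (sym to Adj-sym)
  open import Data.List.Countdown (≡-decSetoid N)
    using (_⊕_; empty; insert; lookup; lookup!; lookupOrInsert)

  record RootedOrder : Set where
    field
      index           : Fin N → ℕ
      parent          : Fin N → Fin N
      index-bound     : ∀ v → index v < N
      index-injective : ∀ {u v} → index u ≡ index v → u ≡ v
      index-root      : index r ≡ 0
      parent-index    : ∀ {v} → v ≢ r → index (parent v) < index v
      parent-adj      : ∀ {v} → v ≢ r → Adj v (parent v)

  record Explored (S : List (Fin N)) : Set where
    field
      index           : Fin N → ℕ
      parent          : Fin N → Fin N
      root-explored   : r ∈ S
      index-root      : index r ≡ 0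
      index-bound     : ∀ {v} → v ∈ S → index v < length S
      index-injective : ∀ {u v} → u ∈ S → v ∈ S → index u ≡ index v → u ≡ v
      parent-explored : ∀ {v} → v ∈ S → v ≢ r → parent v ∈ S
      parent-index    : ∀ {v} → v ∈ S → v ≢ r → index (parent v) < index v
      parent-adj      : ∀ {v} → v ∈ S → v ≢ r → Adj v (parent v)

  explored-root : Explored [ r ]
  explored-root = record
    { index           = const 0
    ; parent          = λ v → v
    ; root-explored   = here refl
    ; index-root      = refl
    ; index-bound     = λ { (here refl) → s≤s z≤n }
    ; index-injective = λ { (here refl) (here refl) _ → refl }
    ; parent-explored = λ { (here refl) r≢r → ⊥-elim (r≢r refl) }
    ; parent-index    = λ { (here refl) r≢r → ⊥-elim (r≢r refl) }
    ; parent-adj      = λ { (here refl) r≢r → ⊥-elim (r≢r refl) }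
    }

  explore : ∀ {S y s} → Explored S → y ∉ S → s ∈ S → Adj y s → Explored (y ∷ S)
  explore {S} {y} {s} X y∉S s∈S y~s = record
    { index           = index′
    ; parent          = parent′
    ; root-explored   = there X.root-explored
    ; index-root      = trans (index-old X.root-explored) X.index-root
    ; index-bound     = λ { (here refl) → ≤-reflexive (cong suc index-new)
                          ; (there v∈S) → m<n⇒m<1+n (subst (_< length S) (sym (index-old v∈S)) (X.index-bound v∈S)) }
    ; index-injective = injective
    ; parent-explored = λ { (here refl) _ → subst (_∈ y ∷ S) (sym parent-new) (there s∈S)
                          ; (there v∈S) v≢r → subst (_∈ y ∷ S) (sym (parent-old v∈S)) (there (X.parent-explored v∈S v≢r)) }
    ; parent-index    = parent-earlier
    ; parent-adj      = λ { (here refl) _ → subst (Adj y) (sym parent-new) y~s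
                          ; {v} (there v∈S) v≢r → subst (Adj v) (sym (parent-old v∈S)) (X.parent-adj v∈S v≢r) }
    }
    where
    module X = Explored X

    index′ : Fin N → ℕ
    index′ = updateAt X.index y (const (length S))

    parent′ : Fin N → Fin N
    parent′ = updateAt X.parent y (const s)

    away : ∀ {v} → v ∈ S → v ≢ y
    away v∈S refl = y∉S v∈S

    index-new : index′ y ≡ length S
    index-new = updateAt-updates y X.index

    parent-new : parent′ y ≡ s
    parent-new = updateAt-updates y X.parent

    index-old : ∀ {v} → v ∈ S → index′ v ≡ X.index v
    index-old v∈S = updateAt-minimal _ y X.index (away v∈S)

    parent-old : ∀ {v} → v ∈ S → parent′ v ≡ X.parent v
    parent-old v∈S = updateAt-minimal _ y X.parent (away v∈S)

    older : ∀ {v} → v ∈ S → index′ v < index′ y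
    older v∈S rewrite index-old v∈S | index-new = X.index-bound v∈S

    injective : ∀ {u v} → u ∈ y ∷ S → v ∈ y ∷ S → index′ u ≡ index′ v → u ≡ v
    injective (here refl) (here refl) _ = refl
    injective (here refl) (there v∈S) eq = ⊥-elim (<-irrefl (sym eq) (older v∈S))
    injective (there u∈S) (here refl) eq = ⊥-elim (<-irrefl eq (older u∈S))
    injective (there u∈S) (there v∈S) eq =
      X.index-injective u∈S v∈S (trans (sym (index-old u∈S)) (trans eq (index-old v∈S)))

    parent-earlier : ∀ {v} → v ∈ y ∷ S → v ≢ r → index′ (parent′ v) < index′ v
    parent-earlier (here refl) _ rewrite parent-new = older s∈S
    parent-earlier (there v∈S) v≢r
      rewrite parent-old v∈S | index-old v∈S | index-old (X.parent-explored v∈S v≢r) =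
      X.parent-index v∈S v≢r

  Spanning : Set
  Spanning = ∃ λ S → Explored S × (∀ v → v ∈ S) × length S ≤ N

  -- In a connected graph, exploration continues until every vertex is
  -- explored; the countdown S ⊕ k bounds the number of unexplored vertices.
  explore-all : InducedConnected (toGraph F) (λ _ → ⊤) →
                ∀ k {S} → Explored S → S ⊕ k → length S + k ≡ N → Spanning
  explore-all _ zero {S} X count len =
    S , X , lookup! count , ≤-reflexive (trans (sym (+-identityʳ _)) len)
  explore-all conn (suc k) {S} X count len with all? (lookup count)
  ... | yes complete = S , X , complete , ≤-trans (m≤m+n _ _) (≤-reflexive len)
  ... | no incomplete with ¬∀⟶∃¬ N _ (lookup count) incomplete
  ... | z , z∉S with exit-edge (lookup count) (conn r z tt tt) (Explored.root-explored X) z∉S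
  ... | s , y , s∈S , y∉S , s~y =
    explore-all conn k (explore X y∉S s∈S (Adj-sym s~y)) (insert count y y∉S)
                (trans (sym (+-suc _ k)) len)

  rooted-order : InducedConnected (toGraph F) (λ _ → ⊤) → RootedOrder
  rooted-order conn with lookupOrInsert (empty (↣-id _)) r
  ... | inj₁ ()
  ... | inj₂ (k , N≡1+k , count) with explore-all conn k explored-root count (sym N≡1+k)
  ... | S , X , complete , short = record
    { index           = X.index
    ; parent          = X.parent
    ; index-bound     = λ v → <-≤-trans (X.index-bound (complete v)) short
    ; index-injective = X.index-injective (complete _) (complete _)
    ; index-root      = X.index-root
    ; parent-index    = X.parent-index (complete _)
    ; parent-adj      = X.parent-adj (complete _)
    }
    where
    module X = Explored X

module Addresses {N : ℕ} {F : SimpleGraph N} {r : Fin N} (O : RootedOrder F r) where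
  open SimpleGraph F using (Adj) renaming (sym to Adj-sym; irrefl to Adj-irrefl)
  open RootedOrder O

  -- Only the root has index 0, so a vertex above another is not the root.
  above-not-root : ∀ {u v} → index u < index v → v ≢ r
  above-not-root {u} u<v refl = n≮0 (subst (index u <_) index-root u<v)

  to-root : ∀ v → WalkIn (toGraph F) (λ z → index z ≤ index v) v r
  to-root v = go v (<-wellFounded (index v))
    where
    go : ∀ v → Acc _<_ (index v) → WalkIn (toGraph F) (λ z → index z ≤ index v) v r
    go v (acc rs) with v ≟ r
    ... | yes refl = here ≤-refl
    ... | no v≢r = step ≤-refl (parent-adj v≢r)
                     (weaken (λ le → ≤-trans le (<⇒≤ (parent-index v≢r))) (go (parent v) (rs (parent-index v≢r))))

  -- In an acyclic graph, the earlier end of an edge is the parent of the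
  -- later one: otherwise v, p v, …, r, …, u, v contains a cycle.
  parent-edge : ¬ Cycle Adj → ∀ {u v} → Adj u v → index u < index v → u ≡ parent v
  parent-edge acyclic {u} {v} u~v u<v with u ≟ parent v
  ... | yes u≡p = u≡p
  ... | no u≢p = ⊥-elim (acyclic (close-cycle _≟_ (parent-adj v≢r) u~v (λ p≡u → u≢p (sym p≡u))
                                     earlier (λ z<v v≡z → <-irrefl (cong index (sym v≡z)) z<v)))
    where
    v≢r : v ≢ r
    v≢r = above-not-root u<v

    earlier : WalkIn (toGraph F) (λ z → index z < index v) (parent v) u
    earlier = weaken (λ le → ≤-<-trans le (parent-index v≢r)) (to-root (parent v))
              ++ʷ reverse Adj-sym (weaken (λ le → ≤-<-trans le u<v) (to-root u))

  edge-parent : ¬ Cycle Adj → ∀ {u v} → Adj u v →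
                (v ≢ r × u ≡ parent v) ⊎ (u ≢ r × v ≡ parent u)
  edge-parent acyclic {u} {v} u~v with <-cmp (index u) (index v)
  ... | tri< u<v _ _ = inj₁ (above-not-root u<v , parent-edge acyclic u~v u<v)
  ... | tri≈ _ u≡v _ = ⊥-elim (Adj-irrefl (subst (Adj u) (sym (index-injective u≡v)) u~v))
  ... | tri> _ _ v<u = inj₂ (above-not-root v<u , parent-edge acyclic (Adj-sym u~v) v<u)

  -- Case distinction used where the goal mentions addresses (a direct
  -- 'with v ≟ r' would also abstract the test inside the address).
  root? : ∀ v → v ≡ r ⊎ v ≢ r
  root? v with v ≟ r
  ... | yes v≡r = inj₁ v≡r
  ... | no v≢r = inj₂ v≢r

  gap : Fin N → ℕ
  gap v = index v ∸ suc (index (parent v))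

  address-acc : ∀ v → Acc _<_ (index v) → List Bool
  address-acc v (acc rs) with v ≟ r
  ... | yes _ = []
  ... | no v≢r = true ∷ falses (gap v) ++ address-acc (parent v) (rs (parent-index v≢r))

  address-acc-irrelevant : ∀ v (a a′ : Acc _<_ (index v)) → address-acc v a ≡ address-acc v a′
  address-acc-irrelevant v (acc rs) (acc rs′) with v ≟ r
  ... | yes _ = refl
  ... | no v≢r = cong (λ t → true ∷ falses (gap v) ++ t)
                   (address-acc-irrelevant (parent v) (rs (parent-index v≢r)) (rs′ (parent-index v≢r)))

  address : Fin N → List Bool
  address v = address-acc v (<-wellFounded (index v))

  address-root : address r ≡ []
  address-root = root (<-wellFounded (index r))
    where
    root : (a : Acc _<_ (index r)) → address-acc r a ≡ []
    root (acc rs) with r ≟ r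
    ... | yes _ = refl
    ... | no r≢r = ⊥-elim (r≢r refl)

  address-unfold : ∀ {v} → v ≢ r → address v ≡ true ∷ falses (gap v) ++ address (parent v)
  address-unfold {v} v≢r = unfold (<-wellFounded (index v))
    where
    unfold : (a : Acc _<_ (index v)) → address-acc v a ≡ true ∷ falses (gap v) ++ address (parent v)
    unfold (acc rs) with v ≟ r
    ... | yes v≡r = ⊥-elim (v≢r v≡r)
    ... | no v≢r′ = cong (λ t → true ∷ falses (gap v) ++ t)
                      (address-acc-irrelevant (parent v) (rs (parent-index v≢r′)) (<-wellFounded _))

  address-length : ∀ v → length (address v) ≡ index v
  address-length v = go v (<-wellFounded (index v))
    where
    open ≡-Reasoning
    go : ∀ v → Acc _<_ (index v) → length (address v) ≡ index v
    go v (acc rs) with root? v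
    ... | inj₁ refl = trans (cong length address-root) (sym index-root)
    ... | inj₂ v≢r = begin
      length (address v)                                   ≡⟨ cong length (address-unfold v≢r) ⟩
      suc (length (falses (gap v) ++ address (parent v)))  ≡⟨ cong suc (length-falses++ (gap v) _) ⟩
      suc (gap v + length (address (parent v)))            ≡⟨ cong (λ l → suc (gap v + l)) (go (parent v) (rs p<v)) ⟩
      suc (gap v + index (parent v))                       ≡⟨ sym (+-suc (gap v) _) ⟩
      gap v + suc (index (parent v))                       ≡⟨ m∸n+n≡m p<v ⟩
      index v                                              ∎
      where
      p<v : index (parent v) < index v
      p<v = parent-index v≢r

  address-no-false : ∀ v → NoLeadingFalse (address v)
  address-no-false v t eq with root? v
  ... | inj₁ refl with trans (sym address-root) eq
  ... | ()
  address-no-false v t eq | inj₂ v≢r with trans (sym (address-unfold v≢r)) eq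
  ... | ()

tree-placement : ∀ {n} (F : SimpleGraph (suc n)) → IsTree F → BinaryPlacement (toGraph F) n
tree-placement {n} F T = record
  { address           = address
  ; address-fits      = λ v → ≤-trans (≤-reflexive (address-length v)) (≤-pred (index-bound v))
  ; address-injective = λ {u} {v} eq →
      index-injective (trans (sym (address-length u)) (trans (cong length eq) (address-length v)))
  ; address-no-false  = address-no-false
  ; address-edge      = hangs
  }
  where
  O = rooted-order F Fin.zero (IsTree.connected T)
  open RootedOrder O
  open Addresses O

  hangs : ∀ {u v} → SimpleGraph.Adj F u v →
          HangsFrom (address u) (address v) ⊎ HangsFrom (address v) (address u)
  hangs u~v with edge-parent (IsTree.acyclic T) u~v
  ... | inj₁ (v≢r , refl) = inj₁ (gap _ , address-unfold v≢r)
  ... | inj₂ (u≢r , refl) = inj₂ (gap _ , address-unfold u≢r)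

lemma2p3 : (n : ℕ) → 1 ≤ n → (F : SimpleGraph n) → IsTree F →
    ∃ λ (M : MinorModel (toGraph F) (Γ (n ∸ 1))) →
      ∀ v → ∃ λ x → MinorModel.branch M v x × IsLeaf {n ∸ 1} x
lemma2p3 (suc n) _ F T = placement⇒minor (tree-placement F T)
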